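{- Let $d \geq 1$ be an integer and let $\mathbb{N}$ denote the set of nonnegative integers. Define $$D^1 = \{ a \in \mathbb{N}^d : a \text{ has an even number of non-zero coordinates, all of which are } 1\},$$ and recursively, for $n \geq 1$, $$D^{n+1} = \bigcup_{a \in 2^{n}D^1} \left(a + D^{n}\right),$$ and let $D = \bigcup_{n \geq 1} D^n$. Let $$P = \{(a_1, \dots, a_d) \in \mathbb{N}^d : a_1 \oplus a_2 \oplus \cdots \oplus a_d = 0\}.$$ Then $P = D$.
   Context: For $D \subseteq \mathbb{N}^d$, $k \in \mathbb{N}$ and $a \in \mathbb{N}^d$, write $kD = \{kx : x \in D\}$ and $a + D = \{a + x : x \in D\}$. The nim-sum $x \oplus y$ of nonnegative integers is the bitwise exclusive-or of their binary expansions, i.e. binary addition without carries; it is commutative and associative. The set $P$ is the set of $P$-positions (previous-player-win positions) of $d$-pile Nim, where a position is recorded as the $d$-tuple of pile sizes. The set $D$ is what the paper calls the full discrete Sierpinski $d$-demihypercube. -}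

module Defs where

open import Data.Nat using (ℕ; zero; suc; _+_; _*_; _^_; _%_; _/_)
open import Data.Bool using (Bool; true; false; _xor_; if_then_else_)
open import Data.Vec using (Vec; foldr; map; zipWith)
open import Data.Vec.Relation.Unary.All using (All)
open import Data.Product using (Σ; _×_; ∃)
open import Data.Sum using (_⊎_)
open import Relation.Binary.PropositionalEquality using (_≡_)

bit0 : ℕ → Bool
bit0 x = if x % 2 Data.Nat.≡ᵇ 1 then true else false

bitVal : Bool → ℕ
bitVal true  = 1
bitVal false = 0

-- Bitwise exclusive-or of the binary expansions, processing at most
-- k bits (least significant first).
xorBits : ℕ → ℕ → ℕ → ℕ
xorBits zero    x y = 0
xorBits (suc k) x y = bitVal (bit0 x xor bit0 y) + 2 * xorBits k (x / 2) (y / 2)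

-- Nim-sum x ⊕ y: bitwise xor.  x + y + 1 bits suffice since
-- x, y < 2 ^ (x + y + 1).
_⊕_ : ℕ → ℕ → ℕ
x ⊕ y = xorBits (suc (x + y)) x y

infixl 6 _⊕_

nimSum : ∀ {d} → Vec ℕ d → ℕ
nimSum = foldr _ _⊕_ 0

P : ∀ {d} → Vec ℕ d → Set
P a = nimSum a ≡ 0

nonZeroCount : ∀ {d} → Vec ℕ d → ℕ
nonZeroCount = foldr _ (λ { zero n → n ; (suc _) n → suc n }) 0

data Even : ℕ → Set where
  even-zero : Even 0
  even-ss   : ∀ {n} → Even n → Even (suc (suc n))

D¹ : ∀ {d} → Vec ℕ d → Set
D¹ a = All (λ x → x ≡ 0 ⊎ x ≡ 1) a × Even (nonZeroCount a)

_·_ : ∀ {d} → ℕ → Vec ℕ d → Vec ℕ d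
k · a = map (k *_) a

_+ᵥ_ : ∀ {d} → Vec ℕ d → Vec ℕ d → Vec ℕ d
_+ᵥ_ = zipWith _+_

-- Dⁿ n x  means  x ∈ D^{n+1}   (shifted so that index 0 is D¹):
-- D^{n+1} = ⋃_{a ∈ 2ⁿ D¹} (a + Dⁿ)
Dⁿ : ∀ {d} → ℕ → Vec ℕ d → Set
Dⁿ zero    x = D¹ x
Dⁿ (suc n) x = Σ _ λ a → Σ _ λ y → D¹ a × Dⁿ n y × (x ≡ ((2 ^ suc n) · a) +ᵥ y)

D : ∀ {d} → Vec ℕ d → Set
D x = ∃ λ n → Dⁿ n x

-- Reading off the lowest binary digit of every coordinate, x = b + 2y
-- with b a 0/1-vector.  The nim-sum of x vanishes iff b has an even
-- number of ones (b ∈ D¹) and the nim-sum of y vanishes.  On the other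
-- side, D^{n+1} is built by peeling off the highest digit, but it is
-- equally the set of b + 2y with b ∈ D¹ and y ∈ Dⁿ.  Both sets therefore
-- obey the same recursion in the lowest digit, and induction on the size
-- of the coordinates (resp. on n) gives P = D.
module Submission where

open import Defs
open import Data.Nat using (ℕ; zero; suc; _+_; _*_; _^_; _%_; _/_; _≤_; _<_; _≥_; z≤n; s≤s; _≡ᵇ_)
open import Data.Nat.Properties
open import Data.Nat.DivMod
open import Data.Nat.Divisibility using (divides)
open import Data.Nat.Solver using (module +-*-Solver)
open import Data.Bool using (Bool; true; false; _xor_; not; if_then_else_)
open import Data.Bool.Properties using (not-involutive)
open import Data.Vec using (Vec; []; _∷_; map; replicate; sum)
open import Data.Vec.Properties using (zipWith-comm; zipWith-identityʳ; map-replicate)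
open import Data.Vec.Relation.Unary.All as All using (All; []; _∷_)
open import Data.Vec.Relation.Unary.All.Properties using (map⁺; gmap)
open import Data.Product using (_×_; ∃₂; _,_)
open import Function using (_∘_)
open import Data.Sum using (_⊎_; inj₁; inj₂)
open import Relation.Binary.PropositionalEquality
open ≡-Reasoning

bit0-bitVal : ∀ c → bit0 (bitVal c) ≡ c
bit0-bitVal false = refl
bit0-bitVal true  = refl

bitVal-bit0 : ∀ x → bitVal (bit0 x) ≡ x % 2
bitVal-bit0 x = bitVal-digit (x % 2) (m%n<n x 2)
  where
  bitVal-digit : ∀ r → r < 2 → bitVal (if r ≡ᵇ 1 then true else false) ≡ r
  bitVal-digit 0 _ = refl
  bitVal-digit 1 _ = refl
  bitVal-digit (suc (suc r)) (s≤s (s≤s ()))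

x≡bit0+2*[x/2] : ∀ x → x ≡ bitVal (bit0 x) + 2 * (x / 2)
x≡bit0+2*[x/2] x = begin
  x                             ≡⟨ m≡m%n+[m/n]*n x 2 ⟩
  x % 2 + x / 2 * 2             ≡⟨ cong₂ _+_ (sym (bitVal-bit0 x)) (*-comm (x / 2) 2) ⟩
  bitVal (bit0 x) + 2 * (x / 2) ∎

bit0-+2* : ∀ x y → bit0 (x + 2 * y) ≡ bit0 x
bit0-+2* x y = cong (λ r → if r ≡ᵇ 1 then true else false) (begin
  (x + 2 * y) % 2 ≡⟨ cong (λ n → (x + n) % 2) (*-comm 2 y) ⟩
  (x + y * 2) % 2 ≡⟨ [m+kn]%n≡m%n x y 2 ⟩
  x % 2           ∎)

bit0-bitVal+2* : ∀ c y → bit0 (bitVal c + 2 * y) ≡ c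
bit0-bitVal+2* c y = trans (bit0-+2* (bitVal c) y) (bit0-bitVal c)

[x+2*y]/2≡x/2+y : ∀ x y → (x + 2 * y) / 2 ≡ x / 2 + y
[x+2*y]/2≡x/2+y x y = begin
  (x + 2 * y) / 2   ≡⟨ +-distrib-/-∣ʳ x (divides y (*-comm 2 y)) ⟩
  x / 2 + 2 * y / 2 ≡⟨ cong (x / 2 +_) (trans (/-congˡ (*-comm 2 y)) (m*n/n≡m y 2)) ⟩
  x / 2 + y         ∎

[bitVal+2*y]/2≡y : ∀ c y → (bitVal c + 2 * y) / 2 ≡ y
[bitVal+2*y]/2≡y false y = [x+2*y]/2≡x/2+y 0 y
[bitVal+2*y]/2≡y true  y = [x+2*y]/2≡x/2+y 1 y

x≤1+k⇒x/2≤k : ∀ {x k} → x ≤ suc k → x / 2 ≤ k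
x≤1+k⇒x/2≤k {zero}  _   = z≤n
x≤1+k⇒x/2≤k {suc x} x≤ = ≤-pred (<-≤-trans (m/n<m (suc x) 2 (s≤s (s≤s z≤n))) x≤)

xorBits-0-0 : ∀ k → xorBits k 0 0 ≡ 0
xorBits-0-0 zero    = refl
xorBits-0-0 (suc k) = cong (2 *_) (xorBits-0-0 k)

xorBits-stable : ∀ {k k′ x y} → x ≤ k → y ≤ k → k ≤ k′ → xorBits k′ x y ≡ xorBits k x y
xorBits-stable {zero} {k′} z≤n z≤n _ = xorBits-0-0 k′
xorBits-stable {suc _} {suc _} {x} {y} x≤ y≤ (s≤s k≤k′) =
  cong (λ h → bitVal (bit0 x xor bit0 y) + 2 * h)
       (xorBits-stable (x≤1+k⇒x/2≤k x≤) (x≤1+k⇒x/2≤k y≤) k≤k′)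

bit0-⊕ : ∀ x y → bit0 (x ⊕ y) ≡ bit0 x xor bit0 y
bit0-⊕ x y = bit0-bitVal+2* (bit0 x xor bit0 y) (xorBits (x + y) (x / 2) (y / 2))

-- The quotient is xorBits on x + y digits and (x/2) ⊕ (y/2) uses x/2 + y/2 + 1;
-- both counts bound x/2 + y/2, which is all xorBits-stable needs.
⊕-/2 : ∀ x y → (x ⊕ y) / 2 ≡ (x / 2) ⊕ (y / 2)
⊕-/2 x y = begin
  (x ⊕ y) / 2
    ≡⟨ [bitVal+2*y]/2≡y (bit0 x xor bit0 y) (xorBits (x + y) (x / 2) (y / 2)) ⟩
  xorBits (x + y) (x / 2) (y / 2)
    ≡⟨ xorBits-stable x/2≤ y/2≤ (+-mono-≤ (m/n≤m x 2) (m/n≤m y 2)) ⟩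
  xorBits (x / 2 + y / 2) (x / 2) (y / 2)
    ≡⟨ sym (xorBits-stable x/2≤ y/2≤ (n≤1+n _)) ⟩
  (x / 2) ⊕ (y / 2)
    ∎
  where
  x/2≤ : x / 2 ≤ x / 2 + y / 2
  x/2≤ = m≤m+n (x / 2) (y / 2)
  y/2≤ : y / 2 ≤ x / 2 + y / 2
  y/2≤ = m≤n+m (y / 2) (x / 2)

IsBit : ℕ → Set
IsBit x = x ≡ 0 ⊎ x ≡ 1

parity : ∀ {d} → Vec ℕ d → Bool
parity []      = false
parity (x ∷ v) = bit0 x xor parity v

lowBits : ∀ {d} → Vec ℕ d → Vec ℕ d
lowBits = map (λ x → bitVal (bit0 x))

halve : ∀ {d} → Vec ℕ d → Vec ℕ d
halve = map (_/ 2)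

v≡lowBits+2·halve : ∀ {d} (v : Vec ℕ d) → v ≡ lowBits v +ᵥ (2 · halve v)
v≡lowBits+2·halve []      = refl
v≡lowBits+2·halve (x ∷ v) = cong₂ _∷_ (x≡bit0+2*[x/2] x) (v≡lowBits+2·halve v)

parity-+2· : ∀ {d} (b y : Vec ℕ d) → parity (b +ᵥ (2 · y)) ≡ parity b
parity-+2· []       []       = refl
parity-+2· (b ∷ bs) (y ∷ ys) = cong₂ _xor_ (bit0-+2* b y) (parity-+2· bs ys)

halve-+2· : ∀ {d} {b : Vec ℕ d} (y : Vec ℕ d) → All IsBit b → halve (b +ᵥ (2 · y)) ≡ y
halve-+2· []       []               = refl
halve-+2· (y ∷ ys) (inj₁ refl ∷ bs) = cong₂ _∷_ ([bitVal+2*y]/2≡y false y) (halve-+2· ys bs)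
halve-+2· (y ∷ ys) (inj₂ refl ∷ bs) = cong₂ _∷_ ([bitVal+2*y]/2≡y true y) (halve-+2· ys bs)

parity-lowBits : ∀ {d} (v : Vec ℕ d) → parity (lowBits v) ≡ parity v
parity-lowBits []      = refl
parity-lowBits (x ∷ v) = cong₂ _xor_ (bit0-bitVal (bit0 x)) (parity-lowBits v)

lowBits-isBit : ∀ {d} (v : Vec ℕ d) → All IsBit (lowBits v)
lowBits-isBit = map⁺ ∘ All.universal (λ x → bitVal-isBit (bit0 x))
  where
  bitVal-isBit : ∀ c → IsBit (bitVal c)
  bitVal-isBit false = inj₁ refl
  bitVal-isBit true  = inj₂ refl

bit0-nimSum : ∀ {d} (v : Vec ℕ d) → bit0 (nimSum v) ≡ parity v
bit0-nimSum []      = refl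
bit0-nimSum (x ∷ v) = trans (bit0-⊕ x (nimSum v)) (cong (bit0 x xor_) (bit0-nimSum v))

nimSum-halve : ∀ {d} (v : Vec ℕ d) → nimSum v / 2 ≡ nimSum (halve v)
nimSum-halve []      = refl
nimSum-halve (x ∷ v) = trans (⊕-/2 x (nimSum v)) (cong ((x / 2) ⊕_) (nimSum-halve v))

P⇒parity≡false : ∀ {d} (v : Vec ℕ d) → P v → parity v ≡ false
P⇒parity≡false v p = trans (sym (bit0-nimSum v)) (cong bit0 p)

P⇒P-halve : ∀ {d} (v : Vec ℕ d) → P v → P (halve v)
P⇒P-halve v p = trans (sym (nimSum-halve v)) (cong (_/ 2) p)

parity≡false×P-halve⇒P : ∀ {d} (v : Vec ℕ d) → parity v ≡ false → P (halve v) → P v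
parity≡false×P-halve⇒P v even p = trans (x≡bit0+2*[x/2] (nimSum v))
  (cong₂ (λ b h → bitVal b + 2 * h) (trans (bit0-nimSum v) even) (trans (nimSum-halve v) p))

odd : ℕ → Bool
odd zero    = false
odd (suc n) = not (odd n)

Even⇒odd≡false : ∀ {n} → Even n → odd n ≡ false
Even⇒odd≡false even-zero          = refl
Even⇒odd≡false (even-ss {n} even) = trans (not-involutive (odd n)) (Even⇒odd≡false even)

odd≡false⇒Even : ∀ n → odd n ≡ false → Even n
odd≡false⇒Even zero          _ = even-zero
odd≡false⇒Even (suc zero)    ()
odd≡false⇒Even (suc (suc n)) p = even-ss (odd≡false⇒Even n (trans (sym (not-involutive (odd n))) p))

odd-nonZeroCount : ∀ {d} {b : Vec ℕ d} → All IsBit b → odd (nonZeroCount b) ≡ parity b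
odd-nonZeroCount []               = refl
odd-nonZeroCount (inj₁ refl ∷ bs) = odd-nonZeroCount bs
odd-nonZeroCount (inj₂ refl ∷ bs) = cong not (odd-nonZeroCount bs)

D¹⇒parity≡false : ∀ {d} {b : Vec ℕ d} → D¹ b → parity b ≡ false
D¹⇒parity≡false (bits , even) = trans (sym (odd-nonZeroCount bits)) (Even⇒odd≡false even)

parity≡false⇒D¹-lowBits : ∀ {d} (v : Vec ℕ d) → parity v ≡ false → D¹ (lowBits v)
parity≡false⇒D¹-lowBits v even = lowBits-isBit v , odd≡false⇒Even _
  (trans (odd-nonZeroCount (lowBits-isBit v)) (trans (parity-lowBits v) even))

All≤0⇒D¹ : ∀ {d} {x : Vec ℕ d} → All (_≤ 0) x → D¹ x
All≤0⇒D¹ []          = [] , even-zero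
All≤0⇒D¹ (z≤n ∷ x≤0) with All≤0⇒D¹ x≤0
... | bits , even = inj₁ refl ∷ bits , even

b+2·[p·a+y]≡2p·a+[b+2·y] : ∀ {d} p (a b y : Vec ℕ d) →
  b +ᵥ (2 · ((p · a) +ᵥ y)) ≡ ((2 * p) · a) +ᵥ (b +ᵥ (2 · y))
b+2·[p·a+y]≡2p·a+[b+2·y] p []       []       []       = refl
b+2·[p·a+y]≡2p·a+[b+2·y] p (a ∷ as) (b ∷ bs) (y ∷ ys) = cong₂ _∷_
  (solve 4 (λ p a b y → b :+ con 2 :* (p :* a :+ y) := (con 2 :* p) :* a :+ (b :+ con 2 :* y)) refl p a b y)
  (b+2·[p·a+y]≡2p·a+[b+2·y] p as bs ys)
  where open +-*-Solver

Dⁿ-suc⁺ : ∀ {d} n {b y : Vec ℕ d} → D¹ b → Dⁿ n y → Dⁿ (suc n) (b +ᵥ (2 · y))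
Dⁿ-suc⁺ zero    {b} {y} b∈D¹ y∈D¹ = y , b , y∈D¹ , b∈D¹ , zipWith-comm +-comm b (2 · y)
Dⁿ-suc⁺ (suc n) {b} b∈D¹ (a , y , a∈D¹ , y∈Dⁿ , refl) =
  a , b +ᵥ (2 · y) , a∈D¹ , Dⁿ-suc⁺ n b∈D¹ y∈Dⁿ , b+2·[p·a+y]≡2p·a+[b+2·y] (2 ^ suc n) a b y

Dⁿ-suc⁻ : ∀ {d} n {x : Vec ℕ d} → Dⁿ (suc n) x →
  ∃₂ λ b y → D¹ b × Dⁿ n y × x ≡ b +ᵥ (2 · y)
Dⁿ-suc⁻ zero    (a , b , a∈D¹ , b∈D¹ , refl) = b , a , b∈D¹ , a∈D¹ , zipWith-comm +-comm (2 · a) b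
Dⁿ-suc⁻ (suc n) (a , y , a∈D¹ , y∈Dⁿ⁺¹ , refl) with Dⁿ-suc⁻ n y∈Dⁿ⁺¹
... | b , z , b∈D¹ , z∈Dⁿ , refl =
  b , ((2 ^ suc n) · a) +ᵥ z , b∈D¹ , (a , z , a∈D¹ , z∈Dⁿ , refl) ,
  sym (b+2·[p·a+y]≡2p·a+[b+2·y] (2 ^ suc n) a b z)

P-+2· : ∀ {d} {b y : Vec ℕ d} → D¹ b → P y → P (b +ᵥ (2 · y))
P-+2· {b = b} {y} b∈D¹@(bits , _) y∈P = parity≡false×P-halve⇒P (b +ᵥ (2 · y))
  (trans (parity-+2· b y) (D¹⇒parity≡false b∈D¹))
  (subst P (sym (halve-+2· y bits)) y∈P)

D¹⇒P : ∀ {d} {x : Vec ℕ d} → D¹ x → P x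
D¹⇒P {d} {x} x∈D¹ = subst P x+2·0≡x (P-+2· x∈D¹ (nimSum-replicate-0 d))
  where
  nimSum-replicate-0 : ∀ d → P (replicate d 0)
  nimSum-replicate-0 zero    = refl
  nimSum-replicate-0 (suc d) = cong (0 ⊕_) (nimSum-replicate-0 d)
  x+2·0≡x : x +ᵥ (2 · replicate d 0) ≡ x
  x+2·0≡x = trans (cong (x +ᵥ_) (map-replicate (2 *_) 0 d)) (zipWith-identityʳ +-identityʳ x)

Dⁿ⇒P : ∀ {d} n {x : Vec ℕ d} → Dⁿ n x → P x
Dⁿ⇒P zero    x∈D¹ = D¹⇒P x∈D¹
Dⁿ⇒P (suc n) x∈Dⁿ⁺¹ with Dⁿ-suc⁻ n x∈Dⁿ⁺¹
... | _ , _ , b∈D¹ , y∈Dⁿ , refl = P-+2· b∈D¹ (Dⁿ⇒P n y∈Dⁿ)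

P⇒D-bounded : ∀ {d} k {x : Vec ℕ d} → All (_≤ k) x → P x → D x
P⇒D-bounded zero    x≤0 _   = zero , All≤0⇒D¹ x≤0
P⇒D-bounded (suc k) {x} x≤ x∈P with P⇒D-bounded k (gmap x≤1+k⇒x/2≤k x≤) (P⇒P-halve x x∈P)
... | n , halve-x∈Dⁿ = suc n , subst (Dⁿ (suc n)) (sym (v≡lowBits+2·halve x))
  (Dⁿ-suc⁺ n (parity≡false⇒D¹-lowBits x (P⇒parity≡false x x∈P)) halve-x∈Dⁿ)

All≤sum : ∀ {d} (x : Vec ℕ d) → All (_≤ sum x) x
All≤sum []       = []
All≤sum (x ∷ xs) = m≤m+n x (sum xs) ∷ All.map (λ h → ≤-trans h (m≤n+m (sum xs) x)) (All≤sum xs)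

mainTheorem1 : (d : ℕ) → d ≥ 1 → (x : Vec ℕ d) → (P x → D x) × (D x → P x)
mainTheorem1 d _ x = P⇒D-bounded (sum x) (All≤sum x) , λ (n , x∈Dⁿ) → Dⁿ⇒P n x∈Dⁿ
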